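{- Let $Q$ be an odd squarefree positive integer and $\Gamma_0(Q)=\{\begin{bmatrix} a&b\\ c&d\end{bmatrix}\in SL_2(\mathbb{Z}): Q\mid c\}$. Let $t\in\mathbb{Z}$ be such that $\sqrt{t^2-4}\notin\mathbb{Q}$, and write $t^2-4=l^2d$ with $l$ a positive integer and $d$ a fundamental discriminant. Let $H_t=\{T\in\Gamma_0(Q):\operatorname{tr}T=t\}$. Then $H_t\neq\emptyset$ if and only if for every prime $q$ dividing $Q$ we have $q\mid l$ or $\left(\frac dq\right)\ne-1$.
   Context: A nonzero integer $d$ is a fundamental discriminant if either $d\equiv1\pmod4$, $d$ squarefree, $d\ne1$; or $d\equiv0\pmod 4$, $d/4\not\equiv1\pmod4$, and $d/4$ squarefree. $\left(\frac dq\right)$ is the Legendre symbol. -}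

module Defs where

open import Data.Nat as ℕ using (ℕ; zero; suc)
open import Data.Nat.Primality using (Prime)
open import Data.Integer as ℤ using (ℤ; +_; _*_; _-_; _+_)
open import Data.Integer.Divisibility using (_∣_)
open import Data.Integer.Divisibility.Signed using (_∣?_)
open import Data.Bool using (Bool; true; false; _∨_; if_then_else_)
open import Relation.Nullary using (¬_; does)
open import Relation.Binary.PropositionalEquality using (_≡_)
open import Data.Product using (_×_; Σ)
open import Data.Sum using (_⊎_)
open import Data.Fin using (Fin)

SquarefreeN : ℕ → Set
SquarefreeN n = ∀ p → Prime p → ¬ ((p ℕ.* p) Data.Nat.Divisibility.∣ n)
  where import Data.Nat.Divisibility

Squarefree : ℤ → Set
Squarefree x = ∀ p → Prime p → ¬ ((+ (p ℕ.* p)) ∣ x)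

_≡_[mod_] : ℤ → ℤ → ℤ → Set
x ≡ y [mod m ] = m ∣ (x - y)

FundamentalDiscriminant : ℤ → Set
FundamentalDiscriminant d =
  ¬ (d ≡ + 0)
  × ( (d ≡ + 1 [mod + 4 ] × Squarefree d × ¬ (d ≡ + 1))
    ⊎ (Σ ℤ λ e → (d ≡ + 4 * e) × ¬ (e ≡ + 1 [mod + 4 ]) × Squarefree e) )

sqrtSearch : ℤ → ℕ → ℕ → Bool
sqrtSearch a q zero = false
sqrtSearch a q (suc n) = does (+ q ∣? ((+ n) * (+ n) - a)) ∨ sqrtSearch a q n

legendre : ℤ → ℕ → ℤ
legendre a q =
  if does (+ q ∣? a) then + 0
  else (if sqrtSearch a q q then + 1 else ℤ.- (+ 1))

record Mat2 : Set where
  constructor mat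
  field
    a b c d : ℤ

open Mat2 public

det : Mat2 → ℤ
det M = a M * d M - b M * c M

tr : Mat2 → ℤ
tr M = a M + d M

InΓ₀ : ℕ → Mat2 → Set
InΓ₀ Q M = (det M ≡ + 1) × (+ Q ∣ c M)

HtNonempty : ℕ → ℤ → Set
HtNonempty Q t = Σ Mat2 λ T → InΓ₀ Q T × (tr T ≡ t)

{-# OPTIONS --safe #-}

-- A matrix [[a, b], [c, d]] ∈ Γ₀(Q) of trace t satisfies a (t - a) - 1 = bc ≡ 0 (mod Q), and
-- conversely a root a of X² - tX + 1 modulo Q, say a (t - a) - 1 = kQ, yields [[a, k], [Q, t - a]].
-- So H_t ≠ ∅ iff X² - tX + 1 has a root modulo Q; as Q is squarefree, by the Chinese remainder
-- theorem iff it has one modulo every prime q ∣ Q.  For odd q, completing the square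
-- (2a - t)² - (t² - 4) = -4 (a (t - a) - 1) makes this equivalent to t² - 4 = l²d being a square
-- modulo q, that is, to q ∣ l or d being a square modulo q, which is (d/q) ≠ -1.

module Submission where

open import Defs
open import Data.Nat as ℕ using (ℕ; suc; NonZero; >-nonZero)
open import Data.Nat.Primality using (Prime; prime[2]; prime⇒irreducible; prime⇒nonZero)
open import Data.Nat.Primality.Factorisation using (factorise; PrimeFactorisation)
open import Data.Nat.Divisibility as ℕD using ()
open import Data.Nat.Coprimality as Coprimality using (Coprime; coprime-Bézout)
open import Data.Nat.GCD using (module Bézout)
open import Data.Nat.ListAction using (product)
open import Data.Nat.Properties using (m<1+n⇒m<n∨m≡n)
open import Data.Integer as ℤ using (ℤ; +_; _*_; _-_; _+_; -_; 0ℤ; 1ℤ; -1ℤ; _%ℕ_; _/ℕ_)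
open import Data.Integer.Properties using (pos-+; pos-*; neg-involutive; neg-distribˡ-*)
open import Data.Integer.DivMod using (a≡a%ℕn+[a/ℕn]*n; n%ℕd<d)
open import Data.Integer.Divisibility.Signed
  using (_∣_; divides; _∣?_; ∣-trans; ∣ᵤ⇒∣; ∣m∣n⇒∣m+n; ∣m∣n⇒∣m-n; ∣m⇒∣-m; ∣n⇒∣m*n; ∣m⇒∣m*n)
open import Data.Integer.Tactic.RingSolver using (solve-∀)
open import Data.Rational as ℚ using (ℚ)
open import Data.Bool using (true; false; _∨_)
open import Data.Bool.Properties using (∨-zeroʳ)
open import Data.List using ([]; _∷_)
open import Data.List.Relation.Unary.All using (All; []; _∷_)
open import Data.Product using (_×_; Σ; _,_; proj₁; proj₂)
open import Data.Sum using (_⊎_; inj₁; inj₂; [_,_])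
open import Data.Sum.Function.Propositional using (_⊎-⇔_)
open import Function.Base using (_∘_)
open import Function.Bundles using (_⇔_; mk⇔; Equivalence)
open import Function.Construct.Composition using (_⇔-∘_)
open import Function.Construct.Identity using (⇔-id)
open import Function.Construct.Symmetry using (⇔-sym)
open import Relation.Nullary using (¬_; yes; no; does; contradiction)
open import Relation.Nullary.Decidable using (dec-true)
open import Relation.Binary.PropositionalEquality
  using (_≡_; refl; sym; trans; cong; cong₂; subst; module ≡-Reasoning)

open ≡-Reasoning

SquareMod : ℤ → ℤ → Set
SquareMod D m = Σ ℤ λ y → m ∣ y * y - D

∣-resp : ∀ {m x y} → m ∣ y → x ≡ y → m ∣ x
∣-resp m∣y refl = m∣y

pos-1+*≡* : ∀ a b c d → 1 ℕ.+ a ℕ.* b ≡ c ℕ.* d → 1ℤ + + a * + b ≡ + c * + d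
pos-1+*≡* a b c d eq = begin
  1ℤ + + a * + b        ≡⟨ cong (λ x → 1ℤ + x) (pos-* a b) ⟨
  1ℤ + + (a ℕ.* b)      ≡⟨ pos-+ 1 (a ℕ.* b) ⟨
  + (1 ℕ.+ a ℕ.* b)     ≡⟨ cong +_ eq ⟩
  + (c ℕ.* d)           ≡⟨ pos-* c d ⟩
  + c * + d             ∎

coprime⇒inverse : ∀ {m n} → Coprime m n → Σ ℤ λ v → + m ∣ v * + n - 1ℤ
coprime⇒inverse {m} {n} m⊥n with coprime-Bézout m⊥n
... | Bézout.+- x y eq = - + y , divides (- + x) (begin
      - + y * + n - 1ℤ    ≡⟨ negate (+ y) (+ n) ⟩
      - (1ℤ + + y * + n)  ≡⟨ cong -_ (pos-1+*≡* y n x m eq) ⟩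
      - (+ x * + m)       ≡⟨ neg-distribˡ-* (+ x) (+ m) ⟩
      - + x * + m         ∎)
  where
  negate : ∀ a b → - a * b - 1ℤ ≡ - (1ℤ + a * b)
  negate = solve-∀
... | Bézout.-+ x y eq = + y , divides (+ x) (begin
      + y * + n - 1ℤ         ≡⟨ cong (_- 1ℤ) (pos-1+*≡* x m y n eq) ⟨
      1ℤ + + x * + m - 1ℤ    ≡⟨ cancel (+ x * + m) ⟩
      + x * + m              ∎)
  where
  cancel : ∀ a → 1ℤ + a - 1ℤ ≡ a
  cancel = solve-∀

prime∤⇒coprime : ∀ {p n} → Prime p → ¬ p ℕD.∣ n → Coprime p n
prime∤⇒coprime p-prime p∤n (d∣p , d∣n) with prime⇒irreducible p-prime d∣p
... | inj₁ d≡1 = d≡1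
... | inj₂ refl = contradiction d∣n p∤n

∣∧∣⇒*∣ : ∀ {m n} v {z} → m ∣ v * n - 1ℤ → m ∣ z → n ∣ z → m * n ∣ z
∣∧∣⇒*∣ {m} {n} v {z} (divides i inverse) (divides j m∣z) (divides k n∣z) =
  divides (j * v - k * i) (begin
    z                                   ≡⟨ split z (v * n) ⟩
    z * (v * n) - z * (v * n - 1ℤ)      ≡⟨ cong₂ (λ p q → p * (v * n) - q * (v * n - 1ℤ)) m∣z n∣z ⟩
    j * m * (v * n) - k * n * (v * n - 1ℤ) ≡⟨ cong (λ r → j * m * (v * n) - k * n * r) inverse ⟩
    j * m * (v * n) - k * n * (i * m)   ≡⟨ regroup j m v n k i ⟩
    (j * v - k * i) * (m * n)           ∎)
  where
  split : ∀ z e → z ≡ z * e - z * (e - 1ℤ)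
  split = solve-∀
  regroup : ∀ j m v n k i → j * m * (v * n) - k * n * (i * m) ≡ (j * v - k * i) * (m * n)
  regroup = solve-∀

squareMod-resp : ∀ {D m} x y → m ∣ x - y → m ∣ y * y - D → m ∣ x * x - D
squareMod-resp {D} x y x≡y y²≡D = ∣-resp (∣m∣n⇒∣m+n y²≡D (∣m⇒∣m*n (x + y) x≡y)) (shift D x y)
  where
  shift : ∀ D x y → x * x - D ≡ (y * y - D) + (x - y) * (x + y)
  shift = solve-∀

∣⇒squareMod : ∀ {D m} → m ∣ D → SquareMod D m
∣⇒squareMod {D} m∣D = 0ℤ , ∣-resp (∣m⇒∣-m m∣D) (zero² D)
  where
  zero² : ∀ D → 0ℤ * 0ℤ - D ≡ - D
  zero² = solve-∀

∣⇒squareMod-* : ∀ {m} L D → m ∣ L → SquareMod (L * L * D) m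
∣⇒squareMod-* L D m∣L = ∣⇒squareMod (∣m⇒∣m*n D (∣m⇒∣m*n L m∣L))

squareMod-*ˡ : ∀ {D m} L → SquareMod D m → SquareMod (L * L * D) m
squareMod-*ˡ {D} L (y , y²≡D) = L * y , ∣-resp (∣n⇒∣m*n (L * L) y²≡D) (scale D L y)
  where
  scale : ∀ D L y → L * y * (L * y) - L * L * D ≡ L * L * (y * y - D)
  scale = solve-∀

squareMod-cancelˡ : ∀ {D m} L v → m ∣ v * L - 1ℤ → SquareMod (L * L * D) m → SquareMod D m
squareMod-cancelˡ {D} L v inverse (y , y²≡L²D) =
  v * y , ∣-resp (∣m∣n⇒∣m+n (∣n⇒∣m*n (v * v) y²≡L²D) (∣m⇒∣m*n ((v * L + 1ℤ) * D) inverse)) (unscale D L v y)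
  where
  unscale : ∀ D L v y → v * y * (v * y) - D ≡ v * v * (y * y - L * L * D) + (v * L - 1ℤ) * ((v * L + 1ℤ) * D)
  unscale = solve-∀

squareMod-l²D⇔ : ∀ {q} l D → Prime q → SquareMod (+ l * + l * D) (+ q) ⇔ (q ℕD.∣ l ⊎ SquareMod D (+ q))
squareMod-l²D⇔ {q} l D q-prime = mk⇔ to [ ∣⇒squareMod-* (+ l) D ∘ ∣ᵤ⇒∣ , squareMod-*ˡ (+ l) ]
  where
  to : SquareMod (+ l * + l * D) (+ q) → q ℕD.∣ l ⊎ SquareMod D (+ q)
  to l²D-square with q ℕD.∣? l
  ... | yes q∣l = inj₁ q∣l
  ... | no q∤l = let v , inverse = coprime⇒inverse (prime∤⇒coprime q-prime q∤l)
                 in inj₂ (squareMod-cancelˡ (+ l) v inverse l²D-square)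

sqrtSearch-sound : ∀ D q n → sqrtSearch D q n ≡ true → SquareMod D (+ q)
sqrtSearch-sound D q (suc n) found with q ℕD.∣? ℤ.∣ + n * + n - D ∣
... | yes q∣n²-D = + n , ∣ᵤ⇒∣ q∣n²-D
... | no _ = sqrtSearch-sound D q n found

sqrtSearch-complete : ∀ D q {n} r → r ℕ.< n → + q ∣ + r * + r - D → sqrtSearch D q n ≡ true
sqrtSearch-complete D q {suc n} r r<1+n q∣r²-D with m<1+n⇒m<n∨m≡n r<1+n
... | inj₂ refl = cong (_∨ sqrtSearch D q n) (dec-true (+ q ∣? (+ n * + n - D)) q∣r²-D)
... | inj₁ r<n = trans (cong (does (+ q ∣? (+ n * + n - D)) ∨_) (sqrtSearch-complete D q r r<n q∣r²-D)) (∨-zeroʳ _)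

squareMod⇒small-root : ∀ {D q} → .{{NonZero q}} → SquareMod D (+ q) →
                       Σ ℕ λ r → r ℕ.< q × + q ∣ + r * + r - D
squareMod⇒small-root {D} {q} (y , y²≡D) =
  y %ℕ q , n%ℕd<d y q , squareMod-resp (+ (y %ℕ q)) y r≡y y²≡D
  where
  r≡y : + q ∣ + (y %ℕ q) - y
  r≡y = divides (- (y /ℕ q)) (begin
    + (y %ℕ q) - y                              ≡⟨ cong (λ z → + (y %ℕ q) - z) (a≡a%ℕn+[a/ℕn]*n y q) ⟩
    + (y %ℕ q) - (+ (y %ℕ q) + y /ℕ q * + q)    ≡⟨ cancel (+ (y %ℕ q)) (y /ℕ q) (+ q) ⟩
    - (y /ℕ q) * + q                            ∎)
    where
    cancel : ∀ r k q → r - (r + k * q) ≡ - k * q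
    cancel = solve-∀

legendre≢-1⇒squareMod : ∀ D q → ¬ legendre D q ≡ -1ℤ → SquareMod D (+ q)
legendre≢-1⇒squareMod D q ≢-1 with q ℕD.∣? ℤ.∣ D ∣ | sqrtSearch D q q in found
... | yes q∣D | _     = ∣⇒squareMod (∣ᵤ⇒∣ q∣D)
... | no _    | true  = sqrtSearch-sound D q q found
... | no _    | false = contradiction refl ≢-1

squareMod⇒legendre≢-1 : ∀ D q → .{{NonZero q}} → SquareMod D (+ q) → ¬ legendre D q ≡ -1ℤ
squareMod⇒legendre≢-1 D q D-square with squareMod⇒small-root D-square
... | r , r<q , q∣r²-D with q ℕD.∣? ℤ.∣ D ∣
...   | yes _ = λ ()
...   | no _ rewrite sqrtSearch-complete D q r r<q q∣r²-D = λ ()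

legendre≢-1⇔squareMod : ∀ D q → .{{NonZero q}} → (¬ legendre D q ≡ -1ℤ) ⇔ SquareMod D (+ q)
legendre≢-1⇔squareMod D q = mk⇔ (legendre≢-1⇒squareMod D q) (squareMod⇒legendre≢-1 D q)

-- a (t - a) ≡ 1 (mod m) says that a is a root modulo m of X² - tX + 1,
-- the characteristic polynomial of every matrix of determinant 1 and trace t.
CharRootMod : ℤ → ℤ → Set
CharRootMod t m = Σ ℤ λ a → m ∣ a * (t - a) - 1ℤ

inΓ₀⇒charRootMod : ∀ {Q T} → InΓ₀ Q T → CharRootMod (tr T) (+ Q)
inΓ₀⇒charRootMod {Q} {mat a b c d} (det≡1 , Q∣c) =
  a , ∣-resp (∣n⇒∣m*n b (∣ᵤ⇒∣ Q∣c)) (begin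
    a * ((a + d) - a) - 1ℤ       ≡⟨ expand a b c d ⟩
    b * c + (a * d - b * c) - 1ℤ ≡⟨ cong (λ δ → b * c + δ - 1ℤ) det≡1 ⟩
    b * c + 1ℤ - 1ℤ              ≡⟨ cancel (b * c) ⟩
    b * c                        ∎)
  where
  expand : ∀ a b c d → a * ((a + d) - a) - 1ℤ ≡ b * c + (a * d - b * c) - 1ℤ
  expand = solve-∀
  cancel : ∀ x → x + 1ℤ - 1ℤ ≡ x
  cancel = solve-∀

charRootMod⇒htNonempty : ∀ {Q t} → CharRootMod t (+ Q) → HtNonempty Q t
charRootMod⇒htNonempty {Q} {t} (a , divides k root) =
  mat a k (+ Q) (t - a) , (det≡1 , ℕD.∣-refl) , trace a t
  where
  trace : ∀ a t → a + (t - a) ≡ t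
  trace = solve-∀
  cancel : ∀ x → x - (x - 1ℤ) ≡ 1ℤ
  cancel = solve-∀
  det≡1 : a * (t - a) - k * + Q ≡ 1ℤ
  det≡1 = begin
    a * (t - a) - k * + Q             ≡⟨ cong (λ x → a * (t - a) - x) root ⟨
    a * (t - a) - (a * (t - a) - 1ℤ)  ≡⟨ cancel (a * (t - a)) ⟩
    1ℤ                                ∎

htNonempty⇔charRootMod : ∀ Q t → HtNonempty Q t ⇔ CharRootMod t (+ Q)
htNonempty⇔charRootMod Q t = mk⇔ (λ { (T , T∈Γ₀ , refl) → inΓ₀⇒charRootMod {Q} {T} T∈Γ₀ }) charRootMod⇒htNonempty

charRootMod-resp : ∀ t {m} x y → m ∣ x - y → m ∣ y * (t - y) - 1ℤ → m ∣ x * (t - x) - 1ℤ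
charRootMod-resp t x y x≡y y-root =
  ∣-resp (∣m∣n⇒∣m+n y-root (∣m⇒∣m*n (t - x - y) x≡y)) (shift t x y)
  where
  shift : ∀ t x y → x * (t - x) - 1ℤ ≡ (y * (t - y) - 1ℤ) + (x - y) * (t - x - y)
  shift = solve-∀

charRootMod-∣ : ∀ {t m n} → m ∣ n → CharRootMod t n → CharRootMod t m
charRootMod-∣ m∣n (a , a-root) = a , ∣-trans m∣n a-root

charRootMod-* : ∀ {t m n} v → m ∣ v * n - 1ℤ → CharRootMod t m → CharRootMod t n → CharRootMod t (m * n)
charRootMod-* {t} {m} {n} v inverse (a , a-root) (b , b-root) =
  x , ∣∧∣⇒*∣ v inverse (charRootMod-resp t x a x≡a a-root) (charRootMod-resp t x b x≡b b-root)
  where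
  x : ℤ
  x = b + (a - b) * (v * n)
  x-a : ∀ a b e → b + (a - b) * e - a ≡ (a - b) * (e - 1ℤ)
  x-a = solve-∀
  x-b : ∀ a b v n → b + (a - b) * (v * n) - b ≡ (a - b) * v * n
  x-b = solve-∀
  x≡a : m ∣ x - a
  x≡a = ∣-resp (∣n⇒∣m*n (a - b) inverse) (x-a a b (v * n))
  x≡b : n ∣ x - b
  x≡b = divides ((a - b) * v) (x-b a b v n)

charRootMod-product : ∀ t {ps} → All Prime ps → SquarefreeN (product ps) →
                      (∀ {q} → Prime q → q ℕD.∣ product ps → CharRootMod t (+ q)) →
                      CharRootMod t (+ product ps)
charRootMod-product t [] _ _ = 0ℤ , ∣ᵤ⇒∣ (ℕD.1∣ _)
charRootMod-product t {p ∷ ps} (p-prime ∷ ps-prime) squarefree roots =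
  subst (CharRootMod t) (sym (pos-* p (product ps)))
    (charRootMod-* {t} (proj₁ inverse) (proj₂ inverse)
      (roots p-prime (ℕD.∣m⇒∣m*n (product ps) ℕD.∣-refl))
      (charRootMod-product t ps-prime
        (λ r r-prime r²∣ps → squarefree r r-prime (ℕD.∣n⇒∣m*n p r²∣ps))
        (λ q-prime q∣ps → roots q-prime (ℕD.∣n⇒∣m*n p q∣ps))))
  where
  p⊥ps : Coprime p (product ps)
  p⊥ps = prime∤⇒coprime p-prime (λ p∣ps → squarefree p p-prime (ℕD.*-monoʳ-∣ p p∣ps))
  inverse : Σ ℤ λ v → + p ∣ v * + product ps - 1ℤ
  inverse = coprime⇒inverse p⊥ps

charRootMod-squarefree : ∀ t {Q} → .{{NonZero Q}} → SquarefreeN Q →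
                         (∀ {q} → Prime q → q ℕD.∣ Q → CharRootMod t (+ q)) → CharRootMod t (+ Q)
charRootMod-squarefree t {Q} squarefree roots =
  subst (λ n → CharRootMod t (+ n)) (sym Q≡Πps)
    (charRootMod-product t factorsPrime (subst SquarefreeN Q≡Πps squarefree)
      (λ q-prime q∣Πps → roots q-prime (subst (_ ℕD.∣_) (sym Q≡Πps) q∣Πps)))
  where
  open PrimeFactorisation (factorise Q) renaming (isFactorisation to Q≡Πps)

completeSquare : ∀ t a → (+ 2 * a - t) * (+ 2 * a - t) - (t * t - + 4) ≡ - (+ 4 * (a * (t - a) - 1ℤ))
completeSquare = solve-∀

charRootMod⇒squareMod : ∀ {t m} → CharRootMod t m → SquareMod (t * t - + 4) m
charRootMod⇒squareMod {t} (a , a-root) =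
  + 2 * a - t , ∣-resp (∣m⇒∣-m (∣n⇒∣m*n (+ 4) a-root)) (completeSquare t a)

∣4*n⇒∣n : ∀ {m} s {x} → m ∣ s * + 2 - 1ℤ → m ∣ + 4 * x → m ∣ x
∣4*n⇒∣n {m} s {x} half m∣4x =
  ∣-resp (∣m∣n⇒∣m-n (∣n⇒∣m*n (s * s) m∣4x) (∣m⇒∣m*n x (∣m⇒∣m*n (s * + 2 + 1ℤ) half))) (split s x)
  where
  split : ∀ s x → x ≡ s * s * (+ 4 * x) - (s * + 2 - 1ℤ) * (s * + 2 + 1ℤ) * x
  split = solve-∀

squareMod⇒charRootMod : ∀ {t m} s → m ∣ s * + 2 - 1ℤ → SquareMod (t * t - + 4) m → CharRootMod t m
squareMod⇒charRootMod {t} {m} s half (y , y²≡D) = x , ∣4*n⇒∣n s half 4x[t-x]≡4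
  where
  x : ℤ
  x = s * (t + y)
  2x-t-y : ∀ s t y → + 2 * (s * (t + y)) - t - y ≡ (s * + 2 - 1ℤ) * (t + y)
  2x-t-y = solve-∀
  2x-t≡y : m ∣ + 2 * x - t - y
  2x-t≡y = ∣-resp (∣m⇒∣m*n (t + y) half) (2x-t-y s t y)
  4x[t-x]≡4 : m ∣ + 4 * (x * (t - x) - 1ℤ)
  4x[t-x]≡4 = ∣-resp (∣m⇒∣-m (squareMod-resp (+ 2 * x - t) y 2x-t≡y y²≡D)) (begin
    + 4 * (x * (t - x) - 1ℤ)          ≡⟨ neg-involutive _ ⟨
    - - (+ 4 * (x * (t - x) - 1ℤ))    ≡⟨ cong -_ (completeSquare t x) ⟨
    - ((+ 2 * x - t) * (+ 2 * x - t) - (t * t - + 4)) ∎)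

mainTheorem12 : (Q : ℕ) → 0 ℕ.< Q → ¬ (2 ℕD.∣ Q) → SquarefreeN Q →
    (t : ℤ) →
    ¬ (Σ ℚ λ r → r ℚ.* r ≡ ℚ._/_ (t * t - + 4) 1) →
    (l : ℕ) → 0 ℕ.< l → (d : ℤ) → FundamentalDiscriminant d →
    t * t - + 4 ≡ (+ l) * (+ l) * d →
    HtNonempty Q t ⇔
      (∀ q → Prime q → q ℕD.∣ Q → (q ℕD.∣ l) ⊎ ¬ (legendre d q ≡ ℤ.- (+ 1)))
mainTheorem12 Q 0<Q 2∤Q squarefree t _ l _ d _ t²-4≡l²d =
  mk⇔ necessary sufficient ⇔-∘ htNonempty⇔charRootMod Q t
  where
  open Equivalence using (to; from)
  squareMod⇔criterion : ∀ {q} → Prime q → SquareMod (t * t - + 4) (+ q) ⇔ (q ℕD.∣ l ⊎ ¬ legendre d q ≡ -1ℤ)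
  squareMod⇔criterion {q} q-prime rewrite t²-4≡l²d =
    (⇔-id _ ⊎-⇔ ⇔-sym (legendre≢-1⇔squareMod d q {{prime⇒nonZero q-prime}})) ⇔-∘ squareMod-l²D⇔ l d q-prime
  inverse-of-2 : ∀ {q} → q ℕD.∣ Q → Σ ℤ λ s → + q ∣ s * + 2 - 1ℤ
  inverse-of-2 q∣Q = coprime⇒inverse (Coprimality.sym (prime∤⇒coprime prime[2] (λ 2∣q → 2∤Q (ℕD.∣-trans 2∣q q∣Q))))
  necessary : CharRootMod t (+ Q) → ∀ q → Prime q → q ℕD.∣ Q → q ℕD.∣ l ⊎ ¬ legendre d q ≡ -1ℤ
  necessary root q q-prime q∣Q =
    to (squareMod⇔criterion q-prime) (charRootMod⇒squareMod {t} (charRootMod-∣ {t} (∣ᵤ⇒∣ q∣Q) root))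
  sufficient : (∀ q → Prime q → q ℕD.∣ Q → q ℕD.∣ l ⊎ ¬ legendre d q ≡ -1ℤ) → CharRootMod t (+ Q)
  sufficient criterion = charRootMod-squarefree t {{>-nonZero 0<Q}} squarefree λ {q} q-prime q∣Q →
    let s , half = inverse-of-2 q∣Q in
    squareMod⇒charRootMod {t} s half (from (squareMod⇔criterion q-prime) (criterion q q-prime q∣Q))
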